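{- Let $n\ge 8$ and let $\mathcal{F}\subset\mathcal{P}([n])$ be a left-compressed up-set which is both $3$-wise intersecting and $3$-intersecting, and which is almost-trivial (every $A\in\mathcal{F}$ with $|A|\le n-3$ contains $1$). If $n$ is odd, then $w(\mathcal{F})\le w(\mathcal{F}_n)$, with equality if and only if $\mathcal{F}=\mathcal{F}_n$. If $n$ is even, then $w(\mathcal{F})<w(\mathcal{F}_{n-1})$.
   Context: $w(\mathcal{F})=|\mathcal{F}|/2^n$ for $\mathcal{F}\subset\mathcal{P}([n])$. A family is $3$-wise intersecting if any three (not necessarily distinct) members have nonempty common intersection, and $3$-intersecting if any two members intersect in at least $3$ elements. A family is left-compressed if for all $1\le i<j\le n$ and $A\in\mathcal{F}$ with $j\in A$, $i\notin A$, we have $(A\setminus\{j\})\cup\{i\}\in\mathcal{F}$; an up-set is closed under supersets. For odd $m\ge 7$, $\mathcal{F}_m=\{A\subset[m]:1\in A,|A|\ge\frac{m+3}{2}\}\cup\{A\subset[m]:1\notin A,|A|\ge m-2\}$; for even $n$, $\mathcal{F}_{n-1}$ is regarded as a family of subsets of $[n-1]$ and $w(\mathcal{F}_{n-1})=|\mathcal{F}_{n-1}|/2^{n-1}$. -}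

module Defs where

open import Data.Bool using (Bool; true; false; if_then_else_)
open import Data.Nat using (ℕ; zero; suc; _+_; _∸_; _≤_; _<_; _≤ᵇ_; ⌊_/2⌋)
open import Data.Fin using (Fin; toℕ) renaming (zero to fzero; _<_ to _<ᶠ_)
open import Data.Fin.Subset using (Subset; inside; outside; _∈_; _∉_; _⊆_; _∩_; ∣_∣; Nonempty)
open import Data.List using (List; []; _∷_; _++_; map)
open import Data.Nat.ListAction using (sum)
open import Data.Vec using (Vec; []; _∷_; _[_]≔_; head)
open import Data.Product using (∃; _×_)
open import Relation.Binary.PropositionalEquality using (_≡_)

-- Ground set [n] is modelled by Fin n, with the element "1" being Fin.zero
-- (element i of [n] corresponds to the Fin with toℕ = i - 1).
Family : ℕ → Set
Family n = Subset n → Bool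

_∈F_ : ∀ {n} → Subset n → Family n → Set
A ∈F F = F A ≡ true

allSubsets : (n : ℕ) → List (Subset n)
allSubsets zero = [] ∷ []
allSubsets (suc n) = map (inside ∷_) (allSubsets n) ++ map (outside ∷_) (allSubsets n)

card : ∀ {n} → Family n → ℕ
card {n} F = sum (map (λ A → if F A then 1 else 0) (allSubsets n))

UpSet : ∀ {n} → Family n → Set
UpSet F = ∀ A B → A ∈F F → A ⊆ B → B ∈F F

LeftCompressed : ∀ {n} → Family n → Set
LeftCompressed F = ∀ i j A → i <ᶠ j → A ∈F F → j ∈ A → i ∉ A →
  ((A [ j ]≔ outside) [ i ]≔ inside) ∈F F

ThreeWiseIntersecting : ∀ {n} → Family n → Set
ThreeWiseIntersecting F = ∀ A B C → A ∈F F → B ∈F F → C ∈F F → Nonempty (A ∩ (B ∩ C))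

ThreeIntersecting : ∀ {n} → Family n → Set
ThreeIntersecting F = ∀ A B → A ∈F F → B ∈F F → 3 ≤ ∣ A ∩ B ∣

AlmostTrivial : ∀ {n} → Family n → Set
AlmostTrivial {n} F = ∀ A → A ∈F F → ∣ A ∣ ≤ n ∸ 3 → ∃ λ (i : Fin n) → toℕ i ≡ 0 × i ∈ A

-- The family F_m ⊂ P([m]) (meaningful for odd m ≥ 7):
--   {A : 1 ∈ A, |A| ≥ (m+3)/2} ∪ {A : 1 ∉ A, |A| ≥ m - 2}
Fam : (m : ℕ) → Family m
Fam zero A = false
Fam (suc k) A with head A
... | true  = ⌊ suc k + 3 /2⌋ ≤ᵇ ∣ A ∣
... | false = suc k ∸ 2 ≤ᵇ ∣ A ∣

-- Split F according to whether a set contains 1.  Almost-triviality forces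
-- the sets avoiding 1 to have size at least n − 2, so there are few of them.
-- The sets containing 1 form, after deleting 1, a left-compressed
-- 2-intersecting family on n − 1 points, which is controlled by Katona's
-- theorem.  For left-compressed families Katona's bound follows from one
-- recursion: the link of a t-intersecting family is (t − 1)-intersecting and,
-- by compression, its deletion is (t + 1)-intersecting.  The same recursion
-- shows that only the family of large sets attains the bound, which gives the
-- equality case for odd n.  For even n, Katona's bound for the link (where
-- n − 1 + 2 is odd) plus the n sets of size at least n − 2 avoiding 1 stays
-- below 2|F_{n−1}|.
module Submission where

open import Defs
open import Data.Nat using (ℕ; _≤_; _<_; _*_; _%_; _∸_)
open import Data.Product using (_×_)
open import Function.Bundles using (_⇔_)
open import Relation.Binary.PropositionalEquality using (_≡_)
open import Data.Fin.Subset using (Subset)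

open import Data.Bool using (true; false; not; if_then_else_)
open import Data.Bool.Properties using (T-≡)
open import Data.Fin using () renaming (zero to fzero; suc to fsuc)
open import Data.Fin.Subset using (inside; outside; _∈_; _∩_; ∣_∣; ∁; ⊥)
open import Data.Fin.Subset.Properties using (∣p∣≤n; ∣∁p∣≡n∸∣p∣; ∣⊥∣≡0; ∩-idem; ∩-inverseʳ)
open import Data.List using (List; map; _++_)
open import Data.List.Properties using (map-++; map-∘; map-cong)
open import Data.Nat using (zero; suc; _+_; _^_; z≤n; s≤s; _≤ᵇ_; _≤?_; ⌊_/2⌋; _/_; NonZero)
open import Data.Nat.DivMod using (m≡m%n+[m/n]*n)
open import Data.Nat.ListAction using (sum)
open import Data.Nat.ListAction.Properties using (sum-++)
open import Data.Nat.Properties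
open import Algebra.Properties.CommutativeSemigroup +-commutativeSemigroup using (interchange)
open import Data.Product using (_,_; proj₁; proj₂; ∃-syntax)
open import Data.Vec using ([]; _∷_; _[_]≔_; here; there)
open import Function.Base using (_∘_)
open import Function.Bundles using (mk⇔; Equivalence)
open import Relation.Nullary using (yes; no; contradiction)
open import Relation.Nullary.Reflects using (ofʸ; ofⁿ)
open import Relation.Binary.PropositionalEquality
  using (refl; sym; trans; cong; cong₂; subst; subst₂; _≗_; module ≡-Reasoning)

m*2≡m+m : ∀ m → m * 2 ≡ m + m
m*2≡m+m m = trans (*-comm m 2) (cong (m +_) (+-identityʳ m))

m+n≡o+p∧m≤o⇒p≤n : ∀ {m n o p} → m + n ≡ o + p → m ≤ o → p ≤ n
m+n≡o+p∧m≤o⇒p≤n eq m≤o = ≮⇒≥ λ n<p → <-irrefl eq (+-mono-≤-< m≤o n<p)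

+-mono-≤-tight : ∀ {m n o p} → m ≤ o → n ≤ p → m + n ≡ o + p → m ≡ o × n ≡ p
+-mono-≤-tight {m} {n} {o} {p} m≤o n≤p eq = m≡o , +-cancelˡ-≡ m n p (trans eq (cong (_+ p) (sym m≡o)))
  where
  m≡o : m ≡ o
  m≡o = ≤-antisym m≤o (m+n≡o+p∧m≤o⇒p≤n (trans (+-comm n m) (trans eq (+-comm o p))) n≤p)

m+n≡o*2∧m<o⇒o<n : ∀ {m n o} → m + n ≡ o * 2 → m < o → o < n
m+n≡o*2∧m<o⇒o<n {o = o} eq =
  m+n≡o+p∧m≤o⇒p≤n (trans (cong suc (trans eq (m*2≡m+m o))) (sym (+-suc o o)))

≤ᵇ-complement : ∀ r a b → a + b ≡ suc (r * 2) → (suc r ≤ᵇ b) ≡ not (suc r ≤ᵇ a)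
≤ᵇ-complement r a b a+b≡
  with suc r ≤ᵇ a | ≤ᵇ-reflects-≤ (suc r) a | suc r ≤ᵇ b | ≤ᵇ-reflects-≤ (suc r) b
... | true  | ofʸ r<a | true  | ofʸ r<b =
  contradiction (m+n≡o+p∧m≤o⇒p≤n (sym (trans a+b≡ (cong suc (m*2≡m+m r)))) r<a) (<⇒≱ r<b)
... | true  | _       | false | _       = refl
... | false | _       | true  | _       = refl
... | false | ofⁿ r≮a | false | ofⁿ r≮b =
  contradiction
    (m+n≡o+p∧m≤o⇒p≤n (trans a+b≡ (trans (cong suc (m*2≡m+m r)) (sym (+-suc r r)))) (≮⇒≥ r≮a)) r≮b

2+n<2*[1+n] : ∀ n .{{_ : NonZero n}} → 2 + n < 2 * suc n
2+n<2*[1+n] n = begin-strict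
  2 + n      <⟨ +-monoʳ-< 2 (m<m*n n 2 ≤-refl) ⟩
  2 + n * 2  ≡⟨ cong (2 +_) (*-comm n 2) ⟩
  2 + 2 * n  ≡⟨ *-suc 2 n ⟨
  2 * suc n  ∎
  where open ≤-Reasoning

∣p∣+∣∁p∣≡n : ∀ {m} (A : Subset m) → ∣ A ∣ + ∣ ∁ A ∣ ≡ m
∣p∣+∣∁p∣≡n A = trans (cong (∣ A ∣ +_) (∣∁p∣≡n∸∣p∣ A)) (m+[n∸m]≡n (∣p∣≤n A))

∃-common-element : ∀ {m} (A B : Subset m) → 1 ≤ ∣ A ∩ B ∣ →
  ∃[ j ] j ∈ A × suc ∣ (A [ j ]≔ outside) ∩ B ∣ ≡ ∣ A ∩ B ∣
∃-common-element [] [] ()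
∃-common-element (inside ∷ A) (inside ∷ B) _ = fzero , here , refl
∃-common-element (inside ∷ A) (outside ∷ B) 1≤∣A∩B∣ with ∃-common-element A B 1≤∣A∩B∣
... | j , j∈A , drop-j = fsuc j , there j∈A , drop-j
∃-common-element (outside ∷ A) (_ ∷ B) 1≤∣A∩B∣ with ∃-common-element A B 1≤∣A∩B∣
... | j , j∈A , drop-j = fsuc j , there j∈A , drop-j

∃-meeting-exactly : ∀ {m} (A : Subset m) r → r ≤ ∣ A ∣ →
  ∃[ B ] ∣ A ∩ B ∣ ≡ r × ∣ B ∣ + ∣ A ∣ ≡ m + r
∃-meeting-exactly [] zero _ = [] , refl , refl
∃-meeting-exactly (outside ∷ A) r r≤∣A∣ with ∃-meeting-exactly A r r≤∣A∣
... | B , A∩B , sizes = inside ∷ B , A∩B , cong suc sizes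
∃-meeting-exactly (inside ∷ A) zero _ with ∃-meeting-exactly A zero z≤n
... | B , A∩B , sizes = outside ∷ B , A∩B , trans (+-suc _ _) (cong suc sizes)
∃-meeting-exactly {suc m} (inside ∷ A) (suc r) (s≤s r≤∣A∣) with ∃-meeting-exactly A r r≤∣A∣
... | B , A∩B , sizes =
  inside ∷ B , cong suc A∩B , cong suc (trans (+-suc _ _) (trans (cong suc sizes) (sym (+-suc m r))))

_⊆F_ : ∀ {m} → Family m → Family m → Set
F ⊆F G = ∀ A → A ∈F F → A ∈F G

link : ∀ {m} → Family (suc m) → Family m
link F A = F (inside ∷ A)

deletion : ∀ {m} → Family (suc m) → Family m
deletion F A = F (outside ∷ A)

≗-link-deletion : ∀ {m} {F G : Family (suc m)} → link F ≗ link G → deletion F ≗ deletion G → F ≗ G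
≗-link-deletion link≗ _ (inside ∷ A) = link≗ A
≗-link-deletion _ deletion≗ (outside ∷ A) = deletion≗ A

card-link+deletion : ∀ {m} (F : Family (suc m)) → card F ≡ card (link F) + card (deletion F)
card-link+deletion {m} F = begin
  sum (map χ (𝒫₁ ++ 𝒫₀))                       ≡⟨ cong sum (map-++ χ 𝒫₁ 𝒫₀) ⟩
  sum (map χ 𝒫₁ ++ map χ 𝒫₀)                   ≡⟨ sum-++ (map χ 𝒫₁) (map χ 𝒫₀) ⟩
  sum (map χ 𝒫₁) + sum (map χ 𝒫₀)              ≡⟨ cong₂ _+_ (cong sum (map-∘ 𝒫)) (cong sum (map-∘ 𝒫)) ⟨
  card (link F) + card (deletion F)            ∎
  where
  open ≡-Reasoning
  𝒫 : List (Subset m)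
  𝒫 = allSubsets m
  𝒫₁ 𝒫₀ : List (Subset (suc m))
  𝒫₁ = map (inside ∷_) 𝒫
  𝒫₀ = map (outside ∷_) 𝒫
  χ : Subset (suc m) → ℕ
  χ A = if F A then 1 else 0

card-cong : ∀ {m} {F G : Family m} → F ≗ G → card F ≡ card G
card-cong {m} F≗G = cong sum (map-cong (λ A → cong (λ b → if b then 1 else 0) (F≗G A)) (allSubsets m))

card-mono : ∀ {m} {F G : Family m} → F ⊆F G → card F ≤ card G
card-mono {zero} {F} {G} F⊆G with F [] in F∋∅ | G [] in G∋∅
... | false | _     = z≤n
... | true  | true  = ≤-refl
... | true  | false = contradiction (trans (sym (F⊆G [] F∋∅)) G∋∅) λ ()
card-mono {suc m} {F} {G} F⊆G = begin
  card F                             ≡⟨ card-link+deletion F ⟩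
  card (link F) + card (deletion F)  ≤⟨ +-mono-≤ (card-mono (λ A → F⊆G (inside ∷ A)))
                                                 (card-mono (λ A → F⊆G (outside ∷ A))) ⟩
  card (link G) + card (deletion G)  ≡⟨ card-link+deletion G ⟨
  card G                             ∎
  where open ≤-Reasoning

⊆∧card≡⇒≗ : ∀ {m} {F G : Family m} → F ⊆F G → card F ≡ card G → F ≗ G
⊆∧card≡⇒≗ {zero} {F} {G} F⊆G card≡ [] with F [] in F∋∅ | G [] in G∋∅
... | false | false = refl
... | true  | true  = refl
... | true  | false = contradiction (trans (sym (F⊆G [] F∋∅)) G∋∅) λ ()
... | false | true  = contradiction card≡ λ ()
⊆∧card≡⇒≗ {suc m} {F} {G} F⊆G card≡ = ≗-link-deletion
  (⊆∧card≡⇒≗ (λ A → F⊆G (inside ∷ A)) (proj₁ tight))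
  (⊆∧card≡⇒≗ (λ A → F⊆G (outside ∷ A)) (proj₂ tight))
  where
  tight : card (link F) ≡ card (link G) × card (deletion F) ≡ card (deletion G)
  tight = +-mono-≤-tight (card-mono (λ A → F⊆G (inside ∷ A))) (card-mono (λ A → F⊆G (outside ∷ A)))
    (trans (sym (card-link+deletion F)) (trans card≡ (card-link+deletion G)))

card-∘∁ : ∀ {m} (F : Family m) → card (F ∘ ∁) ≡ card F
card-∘∁ {zero} F = refl
card-∘∁ {suc m} F = begin
  card (F ∘ ∁)                               ≡⟨ card-link+deletion (F ∘ ∁) ⟩
  card (deletion F ∘ ∁) + card (link F ∘ ∁)  ≡⟨ cong₂ _+_ (card-∘∁ (deletion F)) (card-∘∁ (link F)) ⟩
  card (deletion F) + card (link F)          ≡⟨ +-comm (card (deletion F)) (card (link F)) ⟩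
  card (link F) + card (deletion F)          ≡⟨ card-link+deletion F ⟨
  card F                                     ∎
  where open ≡-Reasoning

card+card-not : ∀ {m} (F : Family m) → card F + card (not ∘ F) ≡ 2 ^ m
card+card-not {zero} F with F []
... | true  = refl
... | false = refl
card+card-not {suc m} F = begin
  card F + card (not ∘ F)
    ≡⟨ cong₂ _+_ (card-link+deletion F) (card-link+deletion (not ∘ F)) ⟩
  (card (link F) + card (deletion F)) + (card (not ∘ link F) + card (not ∘ deletion F))
    ≡⟨ interchange (card (link F)) (card (deletion F)) (card (not ∘ link F)) (card (not ∘ deletion F)) ⟩
  (card (link F) + card (not ∘ link F)) + (card (deletion F) + card (not ∘ deletion F))
    ≡⟨ cong₂ _+_ (card+card-not (link F)) (card+card-not (deletion F)) ⟩
  2 ^ m + 2 ^ m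
    ≡⟨ cong (2 ^ m +_) (+-identityʳ (2 ^ m)) ⟨
  2 ^ suc m
    ∎
  where open ≡-Reasoning

card≤2^n : ∀ {m} (F : Family m) → card F ≤ 2 ^ m
card≤2^n F = subst (card F ≤_) (card+card-not F) (m≤m+n (card F) _)

Intersecting : ∀ {m} → ℕ → Family m → Set
Intersecting t F = ∀ A B → A ∈F F → B ∈F F → t ≤ ∣ A ∩ B ∣

intersecting⇒t≤∣p∣ : ∀ {m t} {F : Family m} → Intersecting t F → ∀ A → A ∈F F → t ≤ ∣ A ∣
intersecting⇒t≤∣p∣ {t = t} int A A∈F = subst (t ≤_) (cong ∣_∣ (∩-idem A)) (int A A A∈F A∈F)

⊥∉intersecting : ∀ {m t} {F : Family m} → Intersecting (suc t) F → F ⊥ ≡ false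
⊥∉intersecting {m} {t} {F} int with F ⊥ in ⊥∈F
... | false = refl
... | true  = contradiction (subst (suc t ≤_) (∣⊥∣≡0 m) (intersecting⇒t≤∣p∣ int ⊥ ⊥∈F)) λ ()

intersecting⇒2*card≤2^n : ∀ {m} {F : Family m} → Intersecting 1 F → 2 * card F ≤ 2 ^ m
intersecting⇒2*card≤2^n {m} {F} int = begin
  2 * card F               ≡⟨ cong (card F +_) (trans (+-identityʳ (card F)) (sym (card-∘∁ F))) ⟩
  card F + card (F ∘ ∁)    ≤⟨ +-monoʳ-≤ (card F) (card-mono disjoint) ⟩
  card F + card (not ∘ F)  ≡⟨ card+card-not F ⟩
  2 ^ m                    ∎
  where
  open ≤-Reasoning
  disjoint : (F ∘ ∁) ⊆F (not ∘ F)
  disjoint A ∁A∈F with F A in A∈F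
  ... | false = refl
  ... | true  = contradiction
    (subst (1 ≤_) (trans (cong ∣_∣ (∩-inverseʳ A)) (∣⊥∣≡0 m)) (int A (∁ A) A∈F ∁A∈F)) λ ()

link-leftCompressed : ∀ {m} {F : Family (suc m)} → LeftCompressed F → LeftCompressed (link F)
link-leftCompressed compressed i j A i<j A∈F j∈A i∉A =
  compressed (fsuc i) (fsuc j) (inside ∷ A) (s≤s i<j) A∈F (there j∈A) λ { (there i∈A) → i∉A i∈A }

deletion-leftCompressed : ∀ {m} {F : Family (suc m)} → LeftCompressed F → LeftCompressed (deletion F)
deletion-leftCompressed compressed i j A i<j A∈F j∈A i∉A =
  compressed (fsuc i) (fsuc j) (outside ∷ A) (s≤s i<j) A∈F (there j∈A) λ { (there i∈A) → i∉A i∈A }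

link-intersecting : ∀ {m t} {F : Family (suc m)} → Intersecting (suc t) F → Intersecting t (link F)
link-intersecting int A B A∈F B∈F = ≤-pred (int (inside ∷ A) (inside ∷ B) A∈F B∈F)

-- Compression moves a common element j of A and B to the point 1, giving a set
-- that meets B in one element fewer.
deletion-intersecting : ∀ {m t} {F : Family (suc m)} → LeftCompressed F →
  Intersecting (suc t) F → Intersecting (suc (suc t)) (deletion F)
deletion-intersecting {F = F} compressed int A B A∈F B∈F
  with ∃-common-element A B (≤-trans (s≤s z≤n) (int (outside ∷ A) (outside ∷ B) A∈F B∈F))
... | j , j∈A , drop-j = subst (_ ≤_) drop-j (s≤s (int _ (outside ∷ B) shifted B∈F))
  where
  shifted : (inside ∷ (A [ j ]≔ outside)) ∈F F
  shifted = compressed fzero (fsuc j) (outside ∷ A) (s≤s z≤n) A∈F (there j∈A) λ ()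

atLeast : (m s : ℕ) → Family m
atLeast _ s A = s ≤ᵇ ∣ A ∣

atLeast-intro : ∀ {m s} (A : Subset m) → s ≤ ∣ A ∣ → A ∈F atLeast m s
atLeast-intro _ = Equivalence.to T-≡ ∘ ≤⇒≤ᵇ

link-atLeast : ∀ m s → link (atLeast (suc m) (suc s)) ≗ atLeast m s
link-atLeast m zero    _ = refl
link-atLeast m (suc s) _ = refl

card-atLeast-suc : ∀ m s → card (atLeast (suc m) (suc s)) ≡ card (atLeast m s) + card (atLeast m (suc s))
card-atLeast-suc m s = trans (card-link+deletion (atLeast (suc m) (suc s)))
  (cong (_+ card (atLeast m (suc s))) (card-cong (link-atLeast m s)))

card-atLeast≡0 : ∀ m s → m < s → card (atLeast m s) ≡ 0
card-atLeast≡0 zero    (suc s) _         = refl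
card-atLeast≡0 (suc m) (suc s) (s≤s m<s) = trans (card-atLeast-suc m s)
  (cong₂ _+_ (card-atLeast≡0 m s m<s) (card-atLeast≡0 m (suc s) (m<n⇒m<1+n m<s)))

card-atLeast-full : ∀ m → card (atLeast m m) ≡ 1
card-atLeast-full zero    = refl
card-atLeast-full (suc m) = trans (card-atLeast-suc m m)
  (cong₂ _+_ (card-atLeast-full m) (card-atLeast≡0 m (suc m) ≤-refl))

card-atLeast-pred : ∀ m → card (atLeast (suc m) m) ≡ suc (suc m)
card-atLeast-pred zero    = refl
card-atLeast-pred (suc m) = trans (card-atLeast-suc (suc m) m)
  (trans (cong₂ _+_ (card-atLeast-pred m) (card-atLeast-full (suc m))) (+-comm (suc (suc m)) 1))

-- On an odd number of points, complementation swaps large and small sets.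
card-atLeast-half : ∀ r → card (atLeast (suc (r * 2)) (suc r)) ≡ 2 ^ (r * 2)
card-atLeast-half r = *-cancelˡ-≡ _ _ 2 (begin
  2 * card X                ≡⟨ cong (card X +_) (trans (+-identityʳ (card X)) (sym (card-∘∁ X))) ⟩
  card X + card (X ∘ ∁)     ≡⟨ cong (card X +_) (card-cong X∘∁≗not∘X) ⟩
  card X + card (not ∘ X)   ≡⟨ card+card-not X ⟩
  2 * 2 ^ (r * 2)           ∎)
  where
  open ≡-Reasoning
  X : Family (suc (r * 2))
  X = atLeast (suc (r * 2)) (suc r)
  X∘∁≗not∘X : X ∘ ∁ ≗ not ∘ X
  X∘∁≗not∘X A = ≤ᵇ-complement r ∣ A ∣ ∣ ∁ A ∣ (∣p∣+∣∁p∣≡n A)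

-- Katona's theorem for left-compressed families

-- Katona's bound for t-intersecting families on m points, in the recursive
-- form given by the link/deletion split.
katona : ℕ → ℕ → ℕ
katona m       zero          = 2 ^ m
katona zero    (suc t)       = 0
katona (suc m) (suc zero)    = 2 ^ m
katona (suc m) (suc (suc t)) = katona m (suc t) + katona m (suc (suc (suc t)))

card≤katona : ∀ {m} t (F : Family m) → LeftCompressed F → Intersecting t F → card F ≤ katona m t
card≤katona zero F _ _ = card≤2^n F
card≤katona {zero} (suc t) F _ int with F [] | ⊥∉intersecting int
... | false | _ = z≤n
card≤katona {suc m} (suc zero) F _ int = *-cancelˡ-≤ 2 (intersecting⇒2*card≤2^n int)
card≤katona {suc m} (suc (suc t)) F compressed int = begin
  card F                                           ≡⟨ card-link+deletion F ⟩
  card (link F) + card (deletion F)                ≤⟨ +-mono-≤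
    (card≤katona (suc t) (link F) (link-leftCompressed compressed) (link-intersecting int))
    (card≤katona (suc (suc (suc t))) (deletion F)
      (deletion-leftCompressed compressed) (deletion-intersecting compressed int)) ⟩
  katona m (suc t) + katona m (suc (suc (suc t)))  ∎
  where open ≤-Reasoning

link-deletion-≡*2 : ∀ m t s → suc m + suc (suc t) ≡ suc s * 2 →
  m + suc t ≡ s * 2 × m + suc (suc (suc t)) ≡ suc s * 2
link-deletion-≡*2 m t s e =
  suc-injective (trans (sym (+-suc m (suc t))) (suc-injective e)) , trans (+-suc m (suc (suc t))) e

katona-even : ∀ m t s → m + suc t ≡ s * 2 → katona m (suc t) ≡ card (atLeast m s)
katona-even zero    t       (suc s) _ = refl
katona-even (suc m) zero    (suc s) e with refl ← suc-injective (trans (+-comm 1 m) (suc-injective e)) =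
  sym (card-atLeast-half s)
katona-even (suc m) (suc t) (suc s) e = begin
  katona m (suc t) + katona m (suc (suc (suc t)))
    ≡⟨ cong₂ _+_ (katona-even m t s e₁) (katona-even m (suc (suc t)) (suc s) e₂) ⟩
  card (atLeast m s) + card (atLeast m (suc s))
    ≡⟨ card-atLeast-suc m s ⟨
  card (atLeast (suc m) (suc s))
    ∎
  where
  open ≡-Reasoning
  e₁ : m + suc t ≡ s * 2
  e₁ = proj₁ (link-deletion-≡*2 m t s e)
  e₂ : m + suc (suc (suc t)) ≡ suc s * 2
  e₂ = proj₂ (link-deletion-≡*2 m t s e)

katona-odd : ∀ m t s → m + suc t ≡ s * 2 → katona (suc m) (suc t) ≡ 2 * card (atLeast m s)
katona-odd zero    (suc t) (suc s) _ = refl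
katona-odd (suc m) zero    (suc s) e with refl ← suc-injective (trans (+-comm 1 m) (suc-injective e)) =
  cong (2 *_) (sym (card-atLeast-half s))
katona-odd (suc m) (suc t) (suc s) e = begin
  katona (suc m) (suc t) + katona (suc m) (suc (suc (suc t)))
    ≡⟨ cong₂ _+_ (katona-odd m t s e₁) (katona-odd m (suc (suc t)) (suc s) e₂) ⟩
  2 * card (atLeast m s) + 2 * card (atLeast m (suc s))
    ≡⟨ *-distribˡ-+ 2 (card (atLeast m s)) (card (atLeast m (suc s))) ⟨
  2 * (card (atLeast m s) + card (atLeast m (suc s)))
    ≡⟨ cong (2 *_) (card-atLeast-suc m s) ⟨
  2 * card (atLeast (suc m) (suc s))
    ∎
  where
  open ≡-Reasoning
  e₁ : m + suc t ≡ s * 2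
  e₁ = proj₁ (link-deletion-≡*2 m t s e)
  e₂ : m + suc (suc (suc t)) ≡ suc s * 2
  e₂ = proj₂ (link-deletion-≡*2 m t s e)

card≤card-atLeast : ∀ {m t} s {F : Family m} → LeftCompressed F → Intersecting (suc t) F →
  m + suc t ≡ s * 2 → card F ≤ card (atLeast m s)
card≤card-atLeast {m} {t} s {F} compressed int e =
  subst (card F ≤_) (katona-even m t s e) (card≤katona (suc t) F compressed int)

-- A small set A in the link is met in exactly t + 1 points by some set B of
-- size at least s + 1; then inside ∷ A and outside ∷ B both lie in F but meet
-- in only t + 1 points.
link⊆atLeast : ∀ {m t} s {F : Family (suc m)} → Intersecting (suc (suc t)) F →
  atLeast m (suc s) ⊆F deletion F → m + suc t ≡ s * 2 → link F ⊆F atLeast m s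
link⊆atLeast {m} {t} s int large⊆deletion e A A∈link with s ≤? ∣ A ∣
... | yes s≤∣A∣ = atLeast-intro A s≤∣A∣
... | no  s≰∣A∣ with ∃-meeting-exactly A (suc t) (intersecting⇒t≤∣p∣ (link-intersecting int) A A∈link)
...   | B , ∣A∩B∣≡ , sizes = contradiction
  (subst (suc (suc t) ≤_) ∣A∩B∣≡
    (int (inside ∷ A) (outside ∷ B) A∈link (large⊆deletion B (atLeast-intro B B-large))))
  (n≮n (suc t))
  where
  B-large : s < ∣ B ∣
  B-large = m+n≡o*2∧m<o⇒o<n (trans (+-comm ∣ A ∣ ∣ B ∣) (trans sizes e)) (≰⇒> s≰∣A∣)

atLeast-unique : ∀ {m} t s (F : Family m) → LeftCompressed F → Intersecting (suc (suc t)) F →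
  m + suc (suc t) ≡ s * 2 → card F ≡ card (atLeast m s) → F ≗ atLeast m s
atLeast-unique {zero}  t (suc s) F _ int _ _ [] = ⊥∉intersecting int
atLeast-unique {suc m} t (suc s) F compressed int e card≡ = ≗-link-deletion link≗ deletion≗
  where
  e₁ : m + suc t ≡ s * 2
  e₁ = proj₁ (link-deletion-≡*2 m t s e)
  e₂ : m + suc (suc (suc t)) ≡ suc s * 2
  e₂ = proj₂ (link-deletion-≡*2 m t s e)
  deletion-compressed : LeftCompressed (deletion F)
  deletion-compressed = deletion-leftCompressed compressed
  deletion-int : Intersecting (suc (suc (suc t))) (deletion F)
  deletion-int = deletion-intersecting compressed int
  tight : card (link F) ≡ card (atLeast m s) × card (deletion F) ≡ card (atLeast m (suc s))
  tight = +-mono-≤-tight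
    (card≤card-atLeast s (link-leftCompressed compressed) (link-intersecting int) e₁)
    (card≤card-atLeast (suc s) deletion-compressed deletion-int e₂)
    (trans (sym (card-link+deletion F)) (trans card≡ (card-atLeast-suc m s)))
  deletion≗ : deletion F ≗ atLeast m (suc s)
  deletion≗ = atLeast-unique (suc t) (suc s) (deletion F) deletion-compressed deletion-int e₂ (proj₂ tight)
  link≗ : link F ≗ link (atLeast (suc m) (suc s))
  link≗ A = trans
    (⊆∧card≡⇒≗ (link⊆atLeast s int (λ B B∈ → trans (deletion≗ B) B∈) e₁) (proj₁ tight) A)
    (sym (link-atLeast m s A))

-- The families F_n

m∸2<n⇒m∸1≤n : ∀ m {n} → m ∸ 2 < n → m ∸ 1 ≤ n
m∸2<n⇒m∸1≤n zero          _ = z≤n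
m∸2<n⇒m∸1≤n (suc zero)    _ = z≤n
m∸2<n⇒m∸1≤n (suc (suc m)) m∸2<n = m∸2<n

almostTrivial⇒deletion⊆atLeast : ∀ {m} {F : Family (suc m)} → AlmostTrivial F →
  deletion F ⊆F atLeast m (m ∸ 1)
almostTrivial⇒deletion⊆atLeast {m} almostTrivial A A∈deletion with ∣ A ∣ ≤? m ∸ 2
... | no  ∣A∣≰m∸2 = atLeast-intro A (m∸2<n⇒m∸1≤n m (≰⇒> ∣A∣≰m∸2))
... | yes ∣A∣≤m∸2 with almostTrivial (outside ∷ A) A∈deletion ∣A∣≤m∸2
...   | fzero  , _  , ()
...   | fsuc _ , () , _

⌊n*2/2⌋≡n : ∀ n → ⌊ n * 2 /2⌋ ≡ n
⌊n*2/2⌋≡n zero    = refl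
⌊n*2/2⌋≡n (suc n) = cong suc (⌊n*2/2⌋≡n n)

link-Fam : ∀ k → link (Fam (suc (k * 2))) ≗ atLeast (k * 2) (suc k)
link-Fam k A = trans (cong (_≤ᵇ suc ∣ A ∣) threshold) (link-atLeast (k * 2) (suc k) A)
  where
  threshold : ⌊ suc (k * 2) + 3 /2⌋ ≡ suc (suc k)
  threshold = trans (cong ⌊_/2⌋ (+-comm (suc (k * 2)) 3)) (cong (suc ∘ suc) (⌊n*2/2⌋≡n k))

card-Fam : ∀ k → card (Fam (suc (k * 2))) ≡ card (atLeast (k * 2) (suc k)) + card (atLeast (k * 2) (k * 2 ∸ 1))
card-Fam k = trans (card-link+deletion (Fam (suc (k * 2))))
  (cong (_+ card (atLeast (k * 2) (k * 2 ∸ 1))) (card-cong (link-Fam k)))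

Fam-odd-extremal : ∀ k (F : Family (suc (k * 2))) → LeftCompressed F → Intersecting 3 F → AlmostTrivial F →
  card F ≤ card (Fam (suc (k * 2))) × (card F ≡ card (Fam (suc (k * 2))) ⇔ F ≗ Fam (suc (k * 2)))
Fam-odd-extremal k F compressed int almostTrivial = card≤ , mk⇔ card≡⇒≗ card-cong
  where
  e : k * 2 + 2 ≡ suc k * 2
  e = +-comm (k * 2) 2
  link≤ : card (link F) ≤ card (atLeast (k * 2) (suc k))
  link≤ = card≤card-atLeast (suc k) (link-leftCompressed compressed) (link-intersecting int) e
  deletion⊆ : deletion F ⊆F atLeast (k * 2) (k * 2 ∸ 1)
  deletion⊆ = almostTrivial⇒deletion⊆atLeast almostTrivial
  card≤ : card F ≤ card (Fam (suc (k * 2)))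
  card≤ = subst₂ _≤_ (sym (card-link+deletion F)) (sym (card-Fam k))
    (+-mono-≤ link≤ (card-mono deletion⊆))
  card≡⇒≗ : card F ≡ card (Fam (suc (k * 2))) → F ≗ Fam (suc (k * 2))
  card≡⇒≗ card≡ = ≗-link-deletion link≗ (⊆∧card≡⇒≗ deletion⊆ (proj₂ tight))
    where
    tight : card (link F) ≡ card (atLeast (k * 2) (suc k)) ×
            card (deletion F) ≡ card (atLeast (k * 2) (k * 2 ∸ 1))
    tight = +-mono-≤-tight link≤ (card-mono deletion⊆)
      (trans (sym (card-link+deletion F)) (trans card≡ (card-Fam k)))
    link≗ : link F ≗ link (Fam (suc (k * 2)))
    link≗ A = trans
      (atLeast-unique 0 (suc k) (link F) (link-leftCompressed compressed) (link-intersecting int) e (proj₁ tight) A)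
      (sym (link-Fam k A))

Fam-even-bound : ∀ k (F : Family (suc (suc (suc k * 2)))) →
  LeftCompressed F → Intersecting 3 F → AlmostTrivial F →
  card F < 2 * card (Fam (suc (suc k * 2)))
Fam-even-bound k F compressed int almostTrivial = begin-strict
  card F                             ≡⟨ card-link+deletion F ⟩
  card (link F) + card (deletion F)  ≤⟨ +-mono-≤ link≤ (card-mono deletion⊆) ⟩
  2 * X + card (atLeast (suc n) n)   ≡⟨ cong (2 * X +_) (card-atLeast-pred n) ⟩
  2 * X + (2 + n)                    <⟨ +-monoʳ-< (2 * X) (2+n<2*[1+n] n) ⟩
  2 * X + 2 * suc n                  ≡⟨ *-distribˡ-+ 2 X (suc n) ⟨
  2 * (X + suc n)                    ≡⟨ cong (λ y → 2 * (X + y)) (card-atLeast-pred (suc (k * 2))) ⟨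
  2 * (X + card (atLeast n (n ∸ 1))) ≡⟨ cong (2 *_) (card-Fam (suc k)) ⟨
  2 * card (Fam (suc n))             ∎
  where
  open ≤-Reasoning
  n : ℕ
  n = suc k * 2
  X : ℕ
  X = card (atLeast n (suc (suc k)))
  link≤ : card (link F) ≤ 2 * X
  link≤ = subst (card (link F) ≤_) (katona-odd n 1 (suc (suc k)) (+-comm n 2))
    (card≤katona 2 (link F) (link-leftCompressed compressed) (link-intersecting int))
  deletion⊆ : deletion F ⊆F atLeast (suc n) n
  deletion⊆ = almostTrivial⇒deletion⊆atLeast almostTrivial

n%2≡1⇒n≡1+k*2 : ∀ n → n % 2 ≡ 1 → ∃[ k ] n ≡ suc (k * 2)
n%2≡1⇒n≡1+k*2 n n%2≡1 = n / 2 , trans (m≡m%n+[m/n]*n n 2) (cong (_+ n / 2 * 2) n%2≡1)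

n%2≡0⇒n≡4+k*2 : ∀ n → 4 ≤ n → n % 2 ≡ 0 → ∃[ k ] n ≡ suc (suc (suc k * 2))
n%2≡0⇒n≡4+k*2 n 4≤n n%2≡0 with n / 2 | trans (m≡m%n+[m/n]*n n 2) (cong (_+ n / 2 * 2) n%2≡0)
... | suc (suc k) | refl = k , refl
... | suc zero    | refl = contradiction 4≤n λ { (s≤s (s≤s ())) }

Fam-odd : ∀ n (F : Family n) → LeftCompressed F → Intersecting 3 F → AlmostTrivial F → n % 2 ≡ 1 →
  card F ≤ card (Fam n) × (card F ≡ card (Fam n) ⇔ F ≗ Fam n)
Fam-odd n F compressed int almostTrivial n%2≡1 with k , refl ← n%2≡1⇒n≡1+k*2 n n%2≡1 =
  Fam-odd-extremal k F compressed int almostTrivial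

Fam-even : ∀ n → 4 ≤ n → (F : Family n) →
  LeftCompressed F → Intersecting 3 F → AlmostTrivial F → n % 2 ≡ 0 →
  card F < 2 * card (Fam (n ∸ 1))
Fam-even n 4≤n F compressed int almostTrivial n%2≡0 with k , refl ← n%2≡0⇒n≡4+k*2 n 4≤n n%2≡0 =
  Fam-even-bound k F compressed int almostTrivial

lemma3 : (n : ℕ) → 8 ≤ n → (F : Family n) →
    LeftCompressed F → UpSet F → ThreeWiseIntersecting F → ThreeIntersecting F →
    AlmostTrivial F →
    ((n % 2 ≡ 1) →
      (card F ≤ card (Fam n)) × ((card F ≡ card (Fam n)) ⇔ (∀ (A : Subset n) → F A ≡ Fam n A)))
    × ((n % 2 ≡ 0) → card F < 2 * card (Fam (n ∸ 1)))
lemma3 n 8≤n F compressed _ _ int almostTrivial =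
  Fam-odd n F compressed int almostTrivial , Fam-even n (m+n≤o⇒n≤o 4 8≤n) F compressed int almostTrivial
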